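{- Let $v\in I(d)$ and let $C\subseteq D$ be $v$-chains ($C$ a subsequence of $D$). Then $w(C)\le w(D)$.
   Context: $k^*:=2d+1-k$; $I(d,2d)$: $d$-element subsets of $\{1,\dots,2d\}$ written increasingly, ordered by $u\le w$ iff $u_i\le w_i$ for all $i$; $I(d)$: those $u$ containing exactly one of $k,k^*$ for each $k$ with an even number of entries exceeding $d$. $R_v=\{(r,c):r\notin v,\ c\in v\}$, $N_v=\{(r,c)\in R_v:r>c\}$, $ON_v=\{(r,c)\in N_v:r<c^*\}$. $(R,C)>(r,c)$ means $R>r$ and $C<c$; a $v$-chain is a sequence $\alpha_1>\dots>\alpha_\ell$ in $ON_v$. For $\alpha=(r,c)$: $p_v(\alpha)=(c^*,c)$, $p_h(\alpha)=(r,r^*)$, $\alpha^\#=(c^*,r^*)$. Consecutive $\alpha_j=(r_j,c_j)$, $\alpha_{j+1}=(r_{j+1},c_{j+1})$ are connected if $r_j\le c_{j+1}^*$ and $r_{j+1}>r_j^*$; connected components are classes of the generated equivalence relation. For connected $C:\alpha_1>\dots>\alpha_\ell$ with $\alpha_\ell=(r_\ell,c_\ell)$: $S_C=\{p_v(\alpha_i)\}_{i\le\ell}$ if $\ell$ even; $\{p_v(\alpha_i)\}_{i\le\ell}\cup\{p_h(\alpha_\ell)\}$ if $\ell$ odd and $r_\ell>r_\ell^*$; $\{p_v(\alpha_i)\}_{i<\ell}\cup\{\alpha_\ell,\alpha_\ell^\#\}$ if $\ell$ odd and $r_\ell<r_\ell^*$; in general $S_C$ is the union over connected components. $w(C)\in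 I(d,2d)$ is obtained from $v$ by removing the column indices and adding the row indices of elements of $S_C$. -}

module Defs where

open import Data.Bool using (Bool; true; false; if_then_else_; _∧_; _∨_; not)
open import Data.Nat using (ℕ; zero; suc; _+_; _*_; _∸_; _≤_; _<_; _>_; _≤ᵇ_; _<ᵇ_; _≡ᵇ_)
open import Data.Product using (_×_; _,_; proj₁; proj₂; ∃-syntax)
open import Data.Sum using (_⊎_)
open import Data.List using (List; []; _∷_; _++_; map; length; upTo; filterᵇ; concatMap)
open import Data.Bool.ListAction using (any)
open import Data.List.Membership.Propositional using (_∈_; _∉_)
open import Data.List.Relation.Unary.Linked using (Linked)
open import Data.List.Relation.Unary.All using (All)
open import Data.List.Relation.Binary.Pointwise using (Pointwise)
open import Relation.Binary.PropositionalEquality using (_≡_)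
open import Relation.Nullary using (¬_)

star : ℕ → ℕ → ℕ
star d k = suc (2 * d) ∸ k

Pair : Set
Pair = ℕ × ℕ

-- elements of I(d,2d): d-element subsets of {1,..,2d}, as strictly increasing lists
record InId2d (d : ℕ) (u : List ℕ) : Set where
  field
    increasing : Linked _<_ u
    len        : length u ≡ d
    bounds     : All (λ x → 1 ≤ x × x ≤ 2 * d) u

_≤I_ : List ℕ → List ℕ → Set
u ≤I w = Pointwise _≤_ u w

IsEven : ℕ → Set
IsEven n = ∃[ m ] n ≡ m + m

record InId (d : ℕ) (u : List ℕ) : Set where
  field
    inId2d  : InId2d d u
    oneOf   : ∀ k → 1 ≤ k → k ≤ 2 * d → (k ∈ u ⊎ star d k ∈ u)
    notBoth : ∀ k → 1 ≤ k → k ≤ 2 * d → ¬ (k ∈ u × star d k ∈ u)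
    evenBig : IsEven (length (filterᵇ (λ x → d <ᵇ x) u))

InON : ℕ → List ℕ → Pair → Set
InON d v (r , c) = r ∉ v × c ∈ v × c < r × r < star d c

_>ᶜ_ : Pair → Pair → Set
(R , C) >ᶜ (r , c) = r < R × C < c

IsChain : ℕ → List ℕ → List Pair → Set
IsChain d v C = All (InON d v) C × Linked _>ᶜ_ C

connected : ℕ → Pair → Pair → Bool
connected d (r , c) (r' , c') = (r ≤ᵇ star d c') ∧ (star d r <ᵇ r')

-- connected components (the equivalence relation generated by consecutive
-- connectedness; its classes are the maximal runs of consecutive connected elements)
attach : ℕ → Pair → List (List Pair) → List (List Pair)
attach d x [] = (x ∷ []) ∷ []
attach d x ([] ∷ gs) = (x ∷ []) ∷ [] ∷ gs
attach d x ((y ∷ g) ∷ gs) =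
  if connected d x y then (x ∷ y ∷ g) ∷ gs else (x ∷ []) ∷ (y ∷ g) ∷ gs

components : ℕ → List Pair → List (List Pair)
components d [] = []
components d (x ∷ xs) = attach d x (components d xs)

pv : ℕ → Pair → Pair
pv d (r , c) = (star d c , c)

ph : ℕ → Pair → Pair
ph d (r , c) = (r , star d r)

sharp : ℕ → Pair → Pair
sharp d (r , c) = (star d c , star d r)

isEven : ℕ → Bool
isEven zero = true
isEven (suc n) = not (isEven n)

oddCase : ℕ → Pair → List Pair → List Pair
oddCase d (r , c) [] =
  if star d r <ᵇ r then pv d (r , c) ∷ ph d (r , c) ∷ []
  else (r , c) ∷ sharp d (r , c) ∷ []
oddCase d α (β ∷ gs) = pv d α ∷ oddCase d β gs

Sconn : ℕ → List Pair → List Pair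
Sconn d [] = []
Sconn d (α ∷ g) =
  if isEven (length (α ∷ g)) then map (pv d) (α ∷ g) else oddCase d α g

S : ℕ → List Pair → List Pair
S d C = concatMap (Sconn d) (components d C)

elemᵇ : ℕ → List ℕ → Bool
elemᵇ x xs = any (λ y → x ≡ᵇ y) xs

w : ℕ → List ℕ → List Pair → List ℕ
w d v C = filterᵇ keep (map suc (upTo (2 * d)))
  where
  SC = S d C
  keep : ℕ → Bool
  keep x = (elemᵇ x v ∧ not (elemᵇ x (map proj₂ SC))) ∨ elemᵇ x (map proj₁ SC)

module Submission where

open import Defs
open import Data.Nat using (ℕ)
open import Data.List using (List)
open import Data.List.Relation.Binary.Sublist.Propositional using (_⊆_)

-- Increasing lists u, w of equal length satisfy u ≤ w entrywise iff for every t the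
-- list w has at most as many entries ≤ t as u. Since w(C) is v with the columns of S_C
-- replaced by its rows (columns distinct and in v, rows distinct and outside v),
--   #{x ∈ w(C) : x ≤ t} = #{x ∈ v : x ≤ t} − Σ_{(r,c) ∈ S_C} ([c ≤ t] − [r ≤ t]),
-- so it suffices that this weight of S_C does not decrease when a single element β is
-- inserted into the chain. S_C is computed by a right-to-left scan of the chain; the
-- scans with and without β are compared through the weight of the closed state and the
-- weight it would have with the parity of the current component flipped.

module Counting where

  open import Data.Bool using (Bool; true; false; T; _∧_; _∨_; if_then_else_)
  open import Data.Nat
  open import Data.Nat.Properties
  open import Data.Nat.Tactic.RingSolver using (solve-∀)
  open import Data.List using (List; []; _∷_; length; filterᵇ)
  open import Data.List.Properties using (filter-accept; filter-reject; filter-none; filter-all)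
  open import Data.List.Relation.Unary.All as All using (All; []; _∷_)
  open import Data.List.Relation.Unary.Any as Any using (here; there)
  open import Data.List.Relation.Unary.Any.Properties using (any⁺; any⁻)
  open import Data.List.Relation.Unary.AllPairs using (AllPairs; []; _∷_)
  open import Data.List.Relation.Unary.Unique.Propositional using (Unique)
  open import Data.List.Relation.Binary.Pointwise using (Pointwise; []; _∷_)
  open import Data.List.Membership.Propositional using (_∈_)
  open import Function using (_∘_)
  open import Relation.Binary.PropositionalEquality
  open import Relation.Nullary using (¬_; yes; no; contradiction)
  open import Relation.Nullary.Decidable using (T?)

  count : {A : Set} → (A → Bool) → List A → ℕ
  count p xs = length (filterᵇ p xs)

  toℕ : Bool → ℕ
  toℕ true = 1
  toℕ false = 0

  count-∷ : {A : Set} (p : A → Bool) (x : A) (xs : List A) → count p (x ∷ xs) ≡ toℕ (p x) + count p xs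
  count-∷ p x xs with p x
  ... | true = refl
  ... | false = refl

  count-cong : {A : Set} {p q : A → Bool} → (∀ x → p x ≡ q x) → ∀ xs → count p xs ≡ count q xs
  count-cong p≗q [] = refl
  count-cong {p = p} {q} p≗q (x ∷ xs) = begin
    count p (x ∷ xs)          ≡⟨ count-∷ p x xs ⟩
    toℕ (p x) + count p xs    ≡⟨ cong₂ _+_ (cong toℕ (p≗q x)) (count-cong p≗q xs) ⟩
    toℕ (q x) + count q xs    ≡⟨ count-∷ q x xs ⟨
    count q (x ∷ xs)          ∎
    where open ≡-Reasoning

  count-linear : {A : Set} (p q p′ q′ : A → Bool) →
    (∀ x → toℕ (p x) + toℕ (q x) ≡ toℕ (p′ x) + toℕ (q′ x)) →
    ∀ xs → count p xs + count q xs ≡ count p′ xs + count q′ xs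
  count-linear p q p′ q′ eq [] = refl
  count-linear p q p′ q′ eq (x ∷ xs) = begin
    count p (x ∷ xs) + count q (x ∷ xs)
      ≡⟨ cong₂ _+_ (count-∷ p x xs) (count-∷ q x xs) ⟩
    (toℕ (p x) + count p xs) + (toℕ (q x) + count q xs)
      ≡⟨ interchange (toℕ (p x)) (count p xs) (toℕ (q x)) (count q xs) ⟩
    (toℕ (p x) + toℕ (q x)) + (count p xs + count q xs)
      ≡⟨ cong₂ _+_ (eq x) (count-linear p q p′ q′ eq xs) ⟩
    (toℕ (p′ x) + toℕ (q′ x)) + (count p′ xs + count q′ xs)
      ≡⟨ interchange (toℕ (p′ x)) (toℕ (q′ x)) (count p′ xs) (count q′ xs) ⟩
    (toℕ (p′ x) + count p′ xs) + (toℕ (q′ x) + count q′ xs)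
      ≡⟨ cong₂ _+_ (count-∷ p′ x xs) (count-∷ q′ x xs) ⟨
    count p′ (x ∷ xs) + count q′ (x ∷ xs) ∎
    where
    open ≡-Reasoning
    interchange : ∀ a b c e → (a + b) + (c + e) ≡ (a + c) + (b + e)
    interchange = solve-∀

  count-none : {A : Set} (p : A → Bool) {xs : List A} → All (λ x → ¬ T (p x)) xs → count p xs ≡ 0
  count-none p none = cong length (filter-none (T? ∘ p) none)

  count-∨ : {A : Set} (p q : A → Bool) → (∀ x → T (p x) → ¬ T (q x)) →
    ∀ xs → count (λ x → p x ∨ q x) xs ≡ count p xs + count q xs
  count-∨ p q disjoint xs = begin
    count (λ x → p x ∨ q x) xs
      ≡⟨ +-identityʳ (count (λ x → p x ∨ q x) xs) ⟨
    count (λ x → p x ∨ q x) xs + 0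
      ≡⟨ cong (count (λ x → p x ∨ q x) xs +_) (count-none (λ x → p x ∧ q x) {xs} (All.tabulate λ _ → no-both _)) ⟨
    count (λ x → p x ∨ q x) xs + count (λ x → p x ∧ q x) xs
      ≡⟨ count-linear _ _ p q (λ x → ∨+∧ (p x) (q x)) xs ⟩
    count p xs + count q xs ∎
    where
    open ≡-Reasoning
    ∨+∧ : ∀ a b → toℕ (a ∨ b) + toℕ (a ∧ b) ≡ toℕ a + toℕ b
    ∨+∧ true true = refl
    ∨+∧ true false = refl
    ∨+∧ false b = +-identityʳ (toℕ b)
    no-both : ∀ x → ¬ T (p x ∧ q x)
    no-both x with p x in ep | q x in eq
    ... | true | true = λ _ → disjoint x (subst T (sym ep) _) (subst T (sym eq) _)
    ... | true | false = λ ()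
    ... | false | _ = λ ()

  filterᵇ-∷ : {A : Set} (p : A → Bool) (x : A) (xs : List A) →
    filterᵇ p (x ∷ xs) ≡ (if p x then x ∷ filterᵇ p xs else filterᵇ p xs)
  filterᵇ-∷ p x xs with p x
  ... | true = refl
  ... | false = refl

  count-filterᵇ : {A : Set} (p q : A → Bool) (xs : List A) → count q (filterᵇ p xs) ≡ count p (filterᵇ q xs)
  count-filterᵇ p q [] = refl
  count-filterᵇ p q (x ∷ xs) rewrite filterᵇ-∷ p x xs | filterᵇ-∷ q x xs with p x in ep | q x in eq
  ... | true | true rewrite ep | eq = cong suc (count-filterᵇ p q xs)
  ... | true | false rewrite eq = count-filterᵇ p q xs
  ... | false | true rewrite ep = count-filterᵇ p q xs
  ... | false | false = count-filterᵇ p q xs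

  ∈⇒elemᵇ : ∀ {x M} → x ∈ M → T (elemᵇ x M)
  ∈⇒elemᵇ {x} x∈M = any⁺ _ (Any.map (λ { refl → ≡⇒≡ᵇ x x refl }) x∈M)

  elemᵇ⇒∈ : ∀ x M → T (elemᵇ x M) → x ∈ M
  elemᵇ⇒∈ x M h = Any.map (≡ᵇ⇒≡ x _) (any⁻ _ M h)

  filterᵇ-≡ᵇ-unique : ∀ {y X} → Unique X → y ∈ X → filterᵇ (_≡ᵇ y) X ≡ y ∷ []
  filterᵇ-≡ᵇ-unique {y} {y ∷ X} (y∉X ∷ _) (here refl) = begin
    filterᵇ (_≡ᵇ y) (y ∷ X)  ≡⟨ filter-accept (T? ∘ (_≡ᵇ y)) {y} {X} (≡⇒≡ᵇ y y refl) ⟩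
    y ∷ filterᵇ (_≡ᵇ y) X
      ≡⟨ cong (y ∷_) (filter-none (T? ∘ (_≡ᵇ y)) (All.map (λ y≢z h → y≢z (sym (≡ᵇ⇒≡ _ y h))) y∉X)) ⟩
    y ∷ []                   ∎
    where open ≡-Reasoning
  filterᵇ-≡ᵇ-unique {y} {z ∷ X} (z∉X ∷ X!) (there y∈X) = begin
    filterᵇ (_≡ᵇ y) (z ∷ X)
      ≡⟨ filter-reject (T? ∘ (_≡ᵇ y)) {z} {X} (λ h → All.lookup z∉X y∈X (≡ᵇ⇒≡ z y h)) ⟩
    filterᵇ (_≡ᵇ y) X        ≡⟨ filterᵇ-≡ᵇ-unique X! y∈X ⟩
    y ∷ []                   ∎
    where open ≡-Reasoning

  count-elemᵇ-filterᵇ : ∀ (p : ℕ → Bool) {X M} → Unique X → Unique M → All (_∈ X) M →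
    count (λ x → elemᵇ x M) (filterᵇ p X) ≡ count p M
  count-elemᵇ-filterᵇ p {X} X! [] [] = count-none (λ _ → false) {filterᵇ p X} (All.tabulate λ _ ())
  count-elemᵇ-filterᵇ p {X} {y ∷ M} X! (y∉M ∷ M!) (y∈X ∷ M⊆X) = begin
    count (λ x → (x ≡ᵇ y) ∨ elemᵇ x M) (filterᵇ p X)
      ≡⟨ count-∨ (_≡ᵇ y) (λ x → elemᵇ x M) disjoint (filterᵇ p X) ⟩
    count (_≡ᵇ y) (filterᵇ p X) + count (λ x → elemᵇ x M) (filterᵇ p X)
      ≡⟨ cong₂ _+_ (count-filterᵇ p (_≡ᵇ y) X) (count-elemᵇ-filterᵇ p X! M! M⊆X) ⟩
    count p (filterᵇ (_≡ᵇ y) X) + count p M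
      ≡⟨ cong (λ ys → count p ys + count p M) (filterᵇ-≡ᵇ-unique X! y∈X) ⟩
    count p (y ∷ []) + count p M
      ≡⟨ cong (_+ count p M) (count-∷ p y []) ⟩
    (toℕ (p y) + 0) + count p M
      ≡⟨ cong (_+ count p M) (+-identityʳ _) ⟩
    toℕ (p y) + count p M
      ≡⟨ count-∷ p y M ⟨
    count p (y ∷ M) ∎
    where
    open ≡-Reasoning
    disjoint : ∀ x → T (x ≡ᵇ y) → ¬ T (elemᵇ x M)
    disjoint x x≡y x∈M with ≡ᵇ⇒≡ x y x≡y
    ... | refl = All.lookup y∉M (elemᵇ⇒∈ x M x∈M) refl

  countUpTo : ℕ → List ℕ → ℕ
  countUpTo t = count (_≤ᵇ t)

  countUpTo-∷-≤ : ∀ {t x} xs → x ≤ t → countUpTo t (x ∷ xs) ≡ suc (countUpTo t xs)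
  countUpTo-∷-≤ {t} {x} xs x≤t = cong length (filter-accept (T? ∘ (_≤ᵇ t)) {x} {xs} (≤⇒≤ᵇ x≤t))

  countUpTo-above : ∀ {t xs} → All (t <_) xs → countUpTo t xs ≡ 0
  countUpTo-above {t} t<xs =
    cong length (filter-none (T? ∘ (_≤ᵇ t)) (All.map (λ t<x x≤t → <⇒≱ t<x (≤ᵇ⇒≤ _ t x≤t)) t<xs))

  pointwise-≤-fromCountUpTo : ∀ {u w} → AllPairs _<_ u → AllPairs _<_ w → length u ≡ length w →
    (∀ t → countUpTo t w ≤ countUpTo t u) → Pointwise _≤_ u w
  pointwise-≤-fromCountUpTo [] [] _ _ = []
  pointwise-≤-fromCountUpTo {a ∷ u} {b ∷ w} (a<u ∷ u<) (b<w ∷ w<) len dom =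
    a≤b ∷ pointwise-≤-fromCountUpTo u< w< (suc-injective len) tails
    where
    a≤b : a ≤ b
    a≤b with a ≤? b
    ... | yes a≤b = a≤b
    ... | no a≰b = contradiction
      (subst₂ _≤_ (countUpTo-∷-≤ {b} w ≤-refl)
                  (countUpTo-above {b} {a ∷ u} (b<a ∷ All.map (<-trans b<a) a<u)) (dom b))
      λ ()
      where b<a = ≰⇒> a≰b
    tails : ∀ t → countUpTo t w ≤ countUpTo t u
    tails t with b ≤? t
    ... | yes b≤t =
      s≤s⁻¹ (subst₂ _≤_ (countUpTo-∷-≤ w b≤t) (countUpTo-∷-≤ u (≤-trans a≤b b≤t)) (dom t))
    ... | no b≰t = subst (_≤ countUpTo t u) (sym (countUpTo-above (All.map (<-trans (≰⇒> b≰t)) b<w))) z≤n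

  countUpTo-all : ∀ {t xs} → All (_≤ t) xs → countUpTo t xs ≡ length xs
  countUpTo-all {t} xs≤t = cong length (filter-all (T? ∘ (_≤ᵇ t)) (All.map ≤⇒≤ᵇ xs≤t))

open Counting

module Sublists where

  open import Data.List using ([]; _∷_; _++_; [_])
  open import Data.List.Properties using (++-assoc)
  open import Data.List.Relation.Unary.AllPairs using (AllPairs; []; _∷_)
  open import Data.List.Relation.Binary.Sublist.Propositional using ([]; _∷_; _∷ʳ_; ⊆-refl)
  open import Data.List.Relation.Binary.Sublist.Propositional.Properties using (All-resp-⊆; ++⁺)
  open import Relation.Binary.Definitions using (Reflexive; Transitive)
  open import Relation.Binary.PropositionalEquality hiding ([_])

  AllPairs-resp-⊆ : {A : Set} {R : A → A → Set} {xs ys : List A} → xs ⊆ ys → AllPairs R ys → AllPairs R xs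
  AllPairs-resp-⊆ [] [] = []
  AllPairs-resp-⊆ (y ∷ʳ σ) (_ ∷ ys!) = AllPairs-resp-⊆ σ ys!
  AllPairs-resp-⊆ (refl ∷ σ) (y↓ys ∷ ys!) = All-resp-⊆ σ y↓ys ∷ AllPairs-resp-⊆ σ ys!

  ⊆-monotone-from-insertions : {A : Set} (P : List A → Set) (_≼_ : List A → List A → Set) →
    (∀ {xs ys} → xs ⊆ ys → P ys → P xs) → Reflexive _≼_ → Transitive _≼_ →
    (∀ xs y ys → P (xs ++ y ∷ ys) → (xs ++ ys) ≼ (xs ++ y ∷ ys)) →
    ∀ {xs ys} → xs ⊆ ys → P ys → xs ≼ ys
  ⊆-monotone-from-insertions P _≼_ P-resp refl≼ trans≼ insert = behind []
    where
    behind : ∀ pre {xs ys} → xs ⊆ ys → P (pre ++ ys) → (pre ++ xs) ≼ (pre ++ ys)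
    behind pre [] _ = refl≼
    behind pre {xs} {y ∷ ys} (.y ∷ʳ σ) p =
      trans≼ (behind pre σ (P-resp (++⁺ ⊆-refl (y ∷ʳ ⊆-refl)) p)) (insert pre y ys p)
    behind pre {y ∷ xs} {y ∷ ys} (refl ∷ σ) p =
      subst₂ _≼_ (++-assoc pre [ y ] xs) (++-assoc pre [ y ] ys)
        (behind (pre ++ [ y ]) σ (subst P (sym (++-assoc pre [ y ] ys)) p))

open Sublists

module Star (d : ℕ) where

  open import Data.Nat
  open import Data.Nat.Properties
  open import Relation.Binary.PropositionalEquality

  star≤ : ∀ a → star d a ≤ suc (2 * d)
  star≤ a = m∸n≤m _ a

  star-antitone : ∀ {a b} → a ≤ b → star d b ≤ star d a
  star-antitone = ∸-monoʳ-≤ (suc (2 * d))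

  star-antitone-< : ∀ {a b} → a < b → b ≤ suc (2 * d) → star d b < star d a
  star-antitone-< = ∸-monoʳ-<

  star-involutive : ∀ {a} → a ≤ suc (2 * d) → star d (star d a) ≡ a
  star-involutive = m∸[m∸n]≡n

  star-injective : ∀ {a b} → a ≤ suc (2 * d) → b ≤ suc (2 * d) → star d a ≡ star d b → a ≡ b
  star-injective = ∸-cancelˡ-≡

  ≤-star-swap : ∀ {a b} → b ≤ suc (2 * d) → a ≤ star d b → b ≤ star d a
  ≤-star-swap {a} {b} b≤N a≤b* = begin
    b                   ≡⟨ star-involutive b≤N ⟨
    star d (star d b)   ≤⟨ star-antitone a≤b* ⟩
    star d a            ∎
    where open ≤-Reasoning

  <-star-swap : ∀ {a b} → b ≤ suc (2 * d) → a < star d b → b < star d a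
  <-star-swap {a} {b} b≤N a<b* = begin-strict
    b                   ≡⟨ star-involutive b≤N ⟨
    star d (star d b)   <⟨ star-antitone-< a<b* (star≤ b) ⟩
    star d a            ∎
    where open ≤-Reasoning

  star-<-swap : ∀ {a b} → b ≤ suc (2 * d) → a ≤ suc (2 * d) → star d b < a → star d a < b
  star-<-swap {a} {b} b≤N a≤N b*<a = begin-strict
    star d a            <⟨ star-antitone-< b*<a a≤N ⟩
    star d (star d b)   ≡⟨ star-involutive b≤N ⟩
    b                   ∎
    where open ≤-Reasoning

open Star

module Chains where

  open import Data.Bool using (T)
  open import Data.Bool.Properties using (T-∧)
  open import Data.Nat
  open import Data.Nat.Properties
  open import Data.Product using (_×_; _,_; proj₁; proj₂)
  open import Data.List.Relation.Unary.All using (All)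
  open import Data.List.Relation.Unary.AllPairs using (AllPairs)
  open import Data.List.Relation.Binary.Sublist.Propositional.Properties using (All-resp-⊆)
  open import Data.List.Relation.Unary.Linked.Properties using (Linked⇒AllPairs)
  open import Function.Bundles using (Equivalence)

  ONShape : ℕ → Pair → Set
  ONShape d (r , c) = c < r × r < star d c

  Chain : ℕ → List ℕ → List Pair → Set
  Chain d v C = All (InON d v) C × AllPairs _>ᶜ_ C

  Chain-resp-⊆ : ∀ {d v C D} → C ⊆ D → Chain d v D → Chain d v C
  Chain-resp-⊆ C⊆D (on , ordered) = All-resp-⊆ C⊆D on , AllPairs-resp-⊆ C⊆D ordered

  InON⇒ONShape : ∀ {d v α} → InON d v α → ONShape d α
  InON⇒ONShape (_ , _ , c<r , r<c*) = c<r , r<c*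

  >ᶜ-trans : ∀ {α β γ} → α >ᶜ β → β >ᶜ γ → α >ᶜ γ
  >ᶜ-trans (rβ<rα , cα<cβ) (rγ<rβ , cβ<cγ) = <-trans rγ<rβ rβ<rα , <-trans cα<cβ cβ<cγ

  IsChain⇒Chain : ∀ {d v C} → IsChain d v C → Chain d v C
  IsChain⇒Chain (on , linked) = on , Linked⇒AllPairs >ᶜ-trans linked

  connected⇒≤star : ∀ d a b → T (connected d a b) → proj₁ a ≤ star d (proj₂ b)
  connected⇒≤star d (ra , ca) (rb , cb) h = ≤ᵇ⇒≤ ra _ (proj₁ (Equivalence.to T-∧ h))

  connected-skip : ∀ d a β b → a >ᶜ β → β >ᶜ b → T (connected d a b) → T (connected d a β)
  connected-skip d (ra , ca) (rβ , cβ) (rb , cb) (rβ<ra , ca<cβ) (rb<rβ , cβ<cb) h =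
    Equivalence.from T-∧
      ( ≤⇒≤ᵇ (≤-trans (≤ᵇ⇒≤ ra _ ra≤cb*) (star-antitone d (<⇒≤ cβ<cb)))
      , <⇒<ᵇ (<-trans (<ᵇ⇒< _ rb ra*<rb) rb<rβ) )
    where
    ra≤cb* = proj₁ (Equivalence.to T-∧ h)
    ra*<rb = proj₂ (Equivalence.to T-∧ h)

open Chains

module Scan where

  open import Data.Bool using (Bool; true; false; not; _∨_; if_then_else_)
  open import Data.Bool.Properties using (∨-assoc; ∨-comm)
  open import Data.Nat using (_≡ᵇ_; _<ᵇ_)
  open import Data.Product using (_×_; _,_; proj₁; proj₂)
  open import Data.List using ([]; _∷_; _++_; map; length; concatMap)
  open import Data.List.Properties using (map-++)
  open import Data.List.Relation.Unary.All as All using (All; []; _∷_)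
  open import Relation.Binary.PropositionalEquality

  -- S′ d C has the same rows and columns as S d C (it takes p_h(α_ℓ), p_v(α_ℓ) in
  -- place of α_ℓ, α_ℓ^#) and is computed by one scan of C from its right end. The
  -- state holds p_v of every element read and p_h of the last element of every
  -- completed odd component, and the parity and last element of the component being
  -- read.
  record ScanState : Set where
    constructor scan
    field
      pairs : List Pair
      odd   : Bool
      last  : Pair
  open ScanState

  withPh : ℕ → Bool → Pair → List Pair → List Pair
  withPh d true  ℓ P = ph d ℓ ∷ P
  withPh d false ℓ P = P

  close : ℕ → ScanState → List Pair
  close d s = withPh d (odd s) (last s) (pairs s)

  push : ℕ → Pair → Bool → ScanState → ScanState
  push d x true  s = scan (pv d x ∷ pairs s) (not (odd s)) (last s)
  push d x false s = scan (pv d x ∷ close d s) true x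

  connectsTo : ℕ → Pair → List Pair → Bool
  connectsTo d x [] = false
  connectsTo d x (y ∷ _) = connected d x y

  scanChain : ℕ → List Pair → ScanState
  scanChain d [] = scan [] false (0 , 0)
  scanChain d (x ∷ xs) = push d x (connectsTo d x xs) (scanChain d xs)

  S′ : ℕ → List Pair → List Pair
  S′ d C = close d (scanChain d C)

  record SameRowsCols (P Q : List Pair) : Set where
    field
      sameRows : ∀ x → elemᵇ x (map proj₁ P) ≡ elemᵇ x (map proj₁ Q)
      sameCols : ∀ x → elemᵇ x (map proj₂ P) ≡ elemᵇ x (map proj₂ Q)
  open SameRowsCols

  sameRC-refl : ∀ {P} → SameRowsCols P P
  sameRC-refl = record { sameRows = λ _ → refl ; sameCols = λ _ → refl }

  sameRC-trans : ∀ {P Q R} → SameRowsCols P Q → SameRowsCols Q R → SameRowsCols P R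
  sameRC-trans PQ QR = record
    { sameRows = λ x → trans (sameRows PQ x) (sameRows QR x)
    ; sameCols = λ x → trans (sameCols PQ x) (sameCols QR x) }

  sameRC-∷ : ∀ p {P Q} → SameRowsCols P Q → SameRowsCols (p ∷ P) (p ∷ Q)
  sameRC-∷ p PQ = record
    { sameRows = λ x → cong (_ ∨_) (sameRows PQ x)
    ; sameCols = λ x → cong (_ ∨_) (sameCols PQ x) }

  ∨-swap : ∀ a b c → a ∨ (b ∨ c) ≡ b ∨ (a ∨ c)
  ∨-swap a b c = trans (sym (∨-assoc a b c)) (trans (cong (_∨ c) (∨-comm a b)) (∨-assoc b a c))

  sameRC-swap : ∀ p q P → SameRowsCols (p ∷ q ∷ P) (q ∷ p ∷ P)
  sameRC-swap p q P = record
    { sameRows = λ x → ∨-swap (x ≡ᵇ proj₁ p) (x ≡ᵇ proj₁ q) _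
    ; sameCols = λ x → ∨-swap (x ≡ᵇ proj₂ p) (x ≡ᵇ proj₂ q) _ }

  elemᵇ-++ : ∀ x M N → elemᵇ x (M ++ N) ≡ elemᵇ x M ∨ elemᵇ x N
  elemᵇ-++ x [] N = refl
  elemᵇ-++ x (y ∷ M) N = trans (cong ((x ≡ᵇ y) ∨_) (elemᵇ-++ x M N)) (sym (∨-assoc (x ≡ᵇ y) _ _))

  sameRC-++ : ∀ {P P′ Q Q′} → SameRowsCols P P′ → SameRowsCols Q Q′ → SameRowsCols (P ++ Q) (P′ ++ Q′)
  sameRC-++ {P} {P′} {Q} {Q′} PP QQ = record
    { sameRows = λ x → same proj₁ x (sameRows PP x) (sameRows QQ x)
    ; sameCols = λ x → same proj₂ x (sameCols PP x) (sameCols QQ x) }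
    where
    same : ∀ (f : Pair → ℕ) x → elemᵇ x (map f P) ≡ elemᵇ x (map f P′) →
      elemᵇ x (map f Q) ≡ elemᵇ x (map f Q′) →
      elemᵇ x (map f (P ++ Q)) ≡ elemᵇ x (map f (P′ ++ Q′))
    same f x eP eQ = begin
      elemᵇ x (map f (P ++ Q))               ≡⟨ cong (elemᵇ x) (map-++ f P Q) ⟩
      elemᵇ x (map f P ++ map f Q)           ≡⟨ elemᵇ-++ x (map f P) (map f Q) ⟩
      elemᵇ x (map f P) ∨ elemᵇ x (map f Q)   ≡⟨ cong₂ _∨_ eP eQ ⟩
      elemᵇ x (map f P′) ∨ elemᵇ x (map f Q′) ≡⟨ elemᵇ-++ x (map f P′) (map f Q′) ⟨
      elemᵇ x (map f P′ ++ map f Q′)         ≡⟨ cong (elemᵇ x) (map-++ f P′ Q′) ⟨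
      elemᵇ x (map f (P′ ++ Q′))             ∎
      where open ≡-Reasoning

  lastOf : Pair → List Pair → Pair
  lastOf α [] = α
  lastOf α (β ∷ g) = lastOf β g

  oddCase-sameRC : ∀ d α g → SameRowsCols (oddCase d α g) (ph d (lastOf α g) ∷ map (pv d) (α ∷ g))
  oddCase-sameRC d (r , c) [] with star d r <ᵇ r
  ... | true = sameRC-swap _ _ []
  ... | false = record
    { sameRows = λ _ → refl
    ; sameCols = λ x → ∨-swap (x ≡ᵇ c) (x ≡ᵇ star d r) false }
  oddCase-sameRC d α (β ∷ g) = sameRC-trans (sameRC-∷ (pv d α) (oddCase-sameRC d β g)) (sameRC-swap _ _ _)

  Sconn-sameRC : ∀ d α g →
    SameRowsCols (Sconn d (α ∷ g)) (withPh d (not (isEven (length (α ∷ g)))) (lastOf α g) (map (pv d) (α ∷ g)))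
  Sconn-sameRC d α g with isEven (length (α ∷ g))
  ... | true = sameRC-refl
  ... | false = oddCase-sameRC d α g

  withPh-++ : ∀ d o ℓ P Q → withPh d o ℓ (P ++ Q) ≡ withPh d o ℓ P ++ Q
  withPh-++ d true ℓ P Q = refl
  withPh-++ d false ℓ P Q = refl

  withPh-sameRC : ∀ d o ℓ {P Q} → SameRowsCols P Q → SameRowsCols (withPh d o ℓ P) (withPh d o ℓ Q)
  withPh-sameRC d true ℓ PQ = sameRC-∷ _ PQ
  withPh-sameRC d false ℓ PQ = PQ

  record ScanOfComponents (d : ℕ) (y : Pair) (ys : List Pair) : Set where
    field
      tail        : List Pair
      rest        : List (List Pair)
      components≡ : components d (y ∷ ys) ≡ (y ∷ tail) ∷ rest
      odd≡        : odd (scanChain d (y ∷ ys)) ≡ not (isEven (length (y ∷ tail)))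
      last≡       : last (scanChain d (y ∷ ys)) ≡ lastOf y tail
      pairs≈      : SameRowsCols (map (pv d) (y ∷ tail) ++ concatMap (Sconn d) rest) (pairs (scanChain d (y ∷ ys)))

  close-sameRC : ∀ {d y ys} (sc : ScanOfComponents d y ys) → let open ScanOfComponents sc in
    SameRowsCols (Sconn d (y ∷ tail) ++ concatMap (Sconn d) rest) (close d (scanChain d (y ∷ ys)))
  close-sameRC {d} {y} {ys} sc = sameRC-trans (sameRC-++ (Sconn-sameRC d y tail) sameRC-refl)
    (subst₂ (λ o ℓ → SameRowsCols (withPh d o ℓ M ++ K) (close d s)) odd≡ last≡
      (subst (λ P → SameRowsCols P (close d s)) (withPh-++ d (odd s) (last s) M K)
        (withPh-sameRC d (odd s) (last s) pairs≈)))
    where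
    open ScanOfComponents sc
    s = scanChain d (y ∷ ys)
    M = map (pv d) (y ∷ tail)
    K = concatMap (Sconn d) rest

  scanOfComponents : ∀ d y ys → ScanOfComponents d y ys
  scanOfComponents d y [] = record
    { tail = [] ; rest = [] ; components≡ = refl ; odd≡ = refl ; last≡ = refl ; pairs≈ = sameRC-refl }
  scanOfComponents d y (z ∷ zs) = byConnection (connected d y z) refl
    where
    sc = scanOfComponents d z zs
    open ScanOfComponents sc
    s = scanChain d (z ∷ zs)
    attached : Bool → List (List Pair)
    attached b = if b then (y ∷ z ∷ tail) ∷ rest else (y ∷ []) ∷ (z ∷ tail) ∷ rest
    byConnection : ∀ b → connected d y z ≡ b → ScanOfComponents d y (z ∷ zs)
    byConnection true e = record
      { tail = z ∷ tail ; rest = rest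
      ; components≡ = trans (cong (attach d y) components≡) (cong attached e)
      ; odd≡ = trans (cong (λ b → odd (push d y b s)) e) (cong not odd≡)
      ; last≡ = trans (cong (λ b → last (push d y b s)) e) last≡
      ; pairs≈ = subst (λ b → SameRowsCols (map (pv d) (y ∷ z ∷ tail) ++ concatMap (Sconn d) rest)
                                             (pairs (push d y b s)))
                   (sym e) (sameRC-∷ (pv d y) pairs≈) }
    byConnection false e = record
      { tail = [] ; rest = (z ∷ tail) ∷ rest
      ; components≡ = trans (cong (attach d y) components≡) (cong attached e)
      ; odd≡ = cong (λ b → odd (push d y b s)) e
      ; last≡ = cong (λ b → last (push d y b s)) e
      ; pairs≈ = subst (λ b → SameRowsCols (pv d y ∷ concatMap (Sconn d) ((z ∷ tail) ∷ rest))
                                             (pairs (push d y b s)))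
                   (sym e) (sameRC-∷ (pv d y) (close-sameRC sc)) }

  S≈S′ : ∀ d C → SameRowsCols (S d C) (S′ d C)
  S≈S′ d [] = sameRC-refl
  S≈S′ d (y ∷ ys) = subst (λ cs → SameRowsCols (concatMap (Sconn d) cs) (S′ d (y ∷ ys)))
    (sym (ScanOfComponents.components≡ sc)) (close-sameRC sc)
    where sc = scanOfComponents d y ys

  last-scanChain : ∀ d {P : Pair → Set} x xs → All P (x ∷ xs) → P (last (scanChain d (x ∷ xs)))
  last-scanChain d x [] (px ∷ _) = px
  last-scanChain d x (y ∷ ys) (px ∷ pys) with connected d x y
  ... | true = last-scanChain d y ys pys
  ... | false = px

  All-S′ : ∀ d {Q : Pair → Set} C → All (λ α → Q (pv d α) × Q (ph d α)) C → All Q (S′ d C)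
  All-S′ d {Q} [] [] = []
  All-S′ d {Q} (y ∷ ys) qs = All-close (scanChain d (y ∷ ys)) (Q-last y ys qs) (All-pairs (y ∷ ys) qs)
    where
    All-close : ∀ s → Q (ph d (last s)) → All Q (pairs s) → All Q (close d s)
    All-close (scan P true ℓ) qℓ qP = qℓ ∷ qP
    All-close (scan P false ℓ) qℓ qP = qP
    Q-last : ∀ y ys → All (λ α → Q (pv d α) × Q (ph d α)) (y ∷ ys) → Q (ph d (last (scanChain d (y ∷ ys))))
    Q-last y ys qs = last-scanChain d {λ α → Q (ph d α)} y ys (All.map proj₂ qs)
    All-pairs : ∀ C → All (λ α → Q (pv d α) × Q (ph d α)) C → All Q (pairs (scanChain d C))
    All-pairs [] [] = []
    All-pairs (x ∷ []) ((qx , _) ∷ []) = qx ∷ []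
    All-pairs (x ∷ y ∷ ys) ((qx , _) ∷ qs) with connected d x y
    ... | true = qx ∷ All-pairs (y ∷ ys) qs
    ... | false = qx ∷ All-close (scanChain d (y ∷ ys)) (Q-last y ys qs) (All-pairs (y ∷ ys) qs)

open Scan

module Weights (d t : ℕ) where

  open import Data.Bool using (Bool; true; false; T; not)
  open import Data.Bool.Properties using (not-involutive)
  open import Data.Nat as ℕ using (_≤ᵇ_)
  import Data.Nat.Properties as ℕ
  open import Data.Integer using (ℤ; +_; _+_; _-_; 0ℤ; _≤_; +≤+)
  open import Data.Integer.Properties
  open import Data.Integer.Tactic.RingSolver using (solve-∀)
  open import Data.Product using (_×_; _,_; proj₁; proj₂)
  open import Data.List using ([]; _∷_; _++_; map)
  open import Data.List.Relation.Unary.All as All using (All; []; _∷_)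
  open import Data.List.Relation.Unary.AllPairs using (AllPairs; []; _∷_)
  open import Relation.Binary.PropositionalEquality
  open import Relation.Nullary using (contradiction)
  open ScanState

  below : ℕ → ℤ
  below y = + toℕ (y ≤ᵇ t)

  weight : Pair → ℤ
  weight (r , c) = below c - below r

  weightSum : List Pair → ℤ
  weightSum [] = 0ℤ
  weightSum (p ∷ P) = weight p + weightSum P

  weightSum-countUpTo : ∀ P →
    weightSum P ≡ + countUpTo t (map proj₂ P) - + countUpTo t (map proj₁ P)
  weightSum-countUpTo [] = refl
  weightSum-countUpTo ((r , c) ∷ P) = begin
    (below c - below r) + weightSum P
      ≡⟨ cong (λ z → (below c - below r) + z) (weightSum-countUpTo P) ⟩
    (below c - below r) + (+ countUpTo t cs - + countUpTo t rs)
      ≡⟨ regroup (below c) (below r) (+ countUpTo t cs) (+ countUpTo t rs) ⟩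
    (below c + + countUpTo t cs) - (below r + + countUpTo t rs)
      ≡⟨ cong₂ _-_ (counted c cs) (counted r rs) ⟩
    + countUpTo t (c ∷ cs) - + countUpTo t (r ∷ rs) ∎
    where
    open ≡-Reasoning
    cs = map proj₂ P
    rs = map proj₁ P
    regroup : ∀ (a b x y : ℤ) → (a - b) + (x - y) ≡ (a + x) - (b + y)
    regroup = solve-∀
    counted : ∀ y ys → below y + + countUpTo t ys ≡ + countUpTo t (y ∷ ys)
    counted y ys = trans (sym (pos-+ (toℕ (y ≤ᵇ t)) (countUpTo t ys))) (cong +_ (sym (count-∷ (_≤ᵇ t) y ys)))

  pending : Bool → Pair → ℤ
  pending true  ℓ = weight (ph d ℓ)
  pending false ℓ = 0ℤ

  closedWeight flippedWeight : ScanState → ℤ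
  closedWeight  s = weightSum (pairs s) + pending (odd s) (last s)
  flippedWeight s = weightSum (pairs s) + pending (not (odd s)) (last s)

  weightSum-close : ∀ s → weightSum (close d s) ≡ closedWeight s
  weightSum-close (scan P true ℓ) = +-comm (weight (ph d ℓ)) (weightSum P)
  weightSum-close (scan P false ℓ) = sym (+-identityʳ (weightSum P))

  closedWeight-push-true : ∀ x s → closedWeight (push d x true s) ≡ weight (pv d x) + flippedWeight s
  closedWeight-push-true x (scan P o ℓ) = +-assoc (weight (pv d x)) (weightSum P) _

  closedWeight-push-false : ∀ x s →
    closedWeight (push d x false s) ≡ (weight (pv d x) + closedWeight s) + weight (ph d x)
  closedWeight-push-false x s = cong (λ z → (weight (pv d x) + z) + weight (ph d x)) (weightSum-close s)

  flippedWeight-push : ∀ x c s → flippedWeight (push d x c s) ≡ weight (pv d x) + closedWeight s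
  flippedWeight-push x true (scan P o ℓ) =
    trans (+-assoc (weight (pv d x)) (weightSum P) _)
          (cong (λ o′ → weight (pv d x) + (weightSum P + pending o′ ℓ)) (not-involutive o))
  flippedWeight-push x false s = trans (+-identityʳ _) (cong (λ z → weight (pv d x) + z) (weightSum-close s))

  below-antitone : ∀ {a b} → a ℕ.≤ b → below b ≤ below a
  below-antitone {a} {b} a≤b with b ≤ᵇ t in b≤t | a ≤ᵇ t in a≤t
  ... | false | _ = +≤+ ℕ.z≤n
  ... | true | true = ≤-refl
  ... | true | false =
    contradiction (ℕ.≤⇒≤ᵇ (ℕ.≤-trans a≤b (ℕ.≤ᵇ⇒≤ b t (subst T (sym b≤t) _)))) (subst T a≤t)

  below-cross : ∀ {a a′ b b′} → a ℕ.≤ a′ → b ℕ.≤ b′ → below a′ - below b ≤ below a - below b′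
  below-cross a≤a′ b≤b′ = +-mono-≤ (below-antitone a≤a′) (neg-mono-≤ (below-antitone b≤b′))

  below-cross-nonneg : ∀ {a a′ b b′} → a ℕ.≤ a′ → b ℕ.≤ b′ →
    0ℤ ≤ (below a - below b′) + (below b - below a′)
  below-cross-nonneg {a} {a′} {b} {b′} a≤a′ b≤b′ = begin
    0ℤ                                               ≤⟨ i≤j⇒0≤j-i (below-cross a≤a′ b≤b′) ⟩
    (below a - below b′) - (below a′ - below b)      ≡⟨ rearrange (below a) (below a′) (below b) (below b′) ⟩
    (below a - below b′) + (below b - below a′)      ∎
    where
    open ≤-Reasoning
    rearrange : ∀ x x′ y y′ → (x - y′) - (x′ - y) ≡ (x - y′) + (y - x′)
    rearrange = solve-∀

  pv+ph-nonneg : ∀ β x → proj₂ β ℕ.≤ proj₁ x → 0ℤ ≤ weight (pv d β) + weight (ph d x)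
  pv+ph-nonneg (r , c) (r′ , c′) c≤r′ = below-cross-nonneg c≤r′ (star-antitone d c≤r′)

  ph≤pv : ∀ β x → ONShape d β → proj₁ x ℕ.≤ star d (proj₂ β) → weight (ph d x) ≤ weight (pv d β)
  ph≤pv (r , c) (r′ , c′) (c<r , r<c*) r′≤c* =
    below-cross (≤-star-swap d c≤N r′≤c*) r′≤c*
    where c≤N = ℕ.<⇒≤ (ℕ.<-trans c<r (ℕ.<-≤-trans r<c* (star≤ d c)))

  pending-step : ∀ β x → ONShape d β → ONShape d x → β >ᶜ x →
    ∀ o → pending o x ≤ weight (pv d β) + pending (not o) x
  pending-step β x onβ onx (rx<rβ , cβ<cx) true =
    ≤-trans (ph≤pv β x onβ (ℕ.<⇒≤ (ℕ.<-trans rx<rβ (proj₂ onβ)))) (≤-reflexive (sym (+-identityʳ _)))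
  pending-step β x onβ onx (rx<rβ , cβ<cx) false =
    pv+ph-nonneg β x (ℕ.<⇒≤ (ℕ.<-trans cβ<cx (proj₁ onx)))

  pending-step-not : ∀ β x → ONShape d β → ONShape d x → β >ᶜ x →
    ∀ o → pending (not o) x ≤ weight (pv d β) + pending o x
  pending-step-not β x onβ onx β>x o =
    subst (λ o′ → pending (not o) x ≤ weight (pv d β) + pending o′ x) (not-involutive o)
      (pending-step β x onβ onx β>x (not o))

  ≤-shift : ∀ X b {a c} → a ≤ b + c → X + a ≤ b + (X + c)
  ≤-shift X b {a} {c} a≤b+c = ≤-trans (+-monoʳ-≤ X a≤b+c) (≤-reflexive (swap X b c))
    where
    swap : ∀ x y z → x + (y + z) ≡ y + (x + z)
    swap = solve-∀

  -- Both components are needed because a connected push swaps the roles of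
  -- closedWeight and flippedWeight.
  record Dominates (sD sC : ScanState) : Set where
    field
      closed≤  : closedWeight sC ≤ closedWeight sD
      flipped≤ : flippedWeight sC ≤ flippedWeight sD
  open Dominates

  push-unconnected-closed≤ : ∀ β s → ONShape d β → closedWeight s ≤ closedWeight (push d β false s)
  push-unconnected-closed≤ β s onβ = begin
    closedWeight s
      ≡⟨ +-identityʳ _ ⟨
    closedWeight s + 0ℤ
      ≤⟨ +-monoʳ-≤ (closedWeight s) (pv+ph-nonneg β β (ℕ.<⇒≤ (proj₁ onβ))) ⟩
    closedWeight s + (weight (pv d β) + weight (ph d β))
      ≡⟨ reassoc (closedWeight s) (weight (pv d β)) (weight (ph d β)) ⟩
    (weight (pv d β) + closedWeight s) + weight (ph d β)
      ≡⟨ closedWeight-push-false β s ⟨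
    closedWeight (push d β false s) ∎
    where
    open ≤-Reasoning
    reassoc : ∀ x y z → x + (y + z) ≡ (y + x) + z
    reassoc = solve-∀

  push-dominates : ∀ β c s → ONShape d β → ONShape d (last s) → β >ᶜ last s →
    Dominates (push d β c s) s
  push-dominates β c (scan P o ℓ) onβ onℓ β>ℓ = record { closed≤ = closed c ; flipped≤ = flipped }
    where
    s = scan P o ℓ
    closed : ∀ c → closedWeight s ≤ closedWeight (push d β c s)
    closed true = ≤-trans (≤-shift (weightSum P) (weight (pv d β)) (pending-step β ℓ onβ onℓ β>ℓ o))
                          (≤-reflexive (sym (closedWeight-push-true β s)))
    closed false = push-unconnected-closed≤ β s onβ
    flipped : flippedWeight s ≤ flippedWeight (push d β c s)
    flipped = ≤-trans (≤-shift (weightSum P) (weight (pv d β)) (pending-step-not β ℓ onβ onℓ β>ℓ o))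
                      (≤-reflexive (sym (flippedWeight-push β c s)))

  push-connected-monotone : ∀ x {sD sC} → Dominates sD sC → Dominates (push d x true sD) (push d x true sC)
  push-connected-monotone x {sD} {sC} D≥C = record
    { closed≤ = subst₂ _≤_ (sym (closedWeight-push-true x sC)) (sym (closedWeight-push-true x sD))
                  (+-monoʳ-≤ (weight (pv d x)) (flipped≤ D≥C))
    ; flipped≤ = subst₂ _≤_ (sym (flippedWeight-push x true sC)) (sym (flippedWeight-push x true sD))
                  (+-monoʳ-≤ (weight (pv d x)) (closed≤ D≥C)) }

  push-unconnected-monotone : ∀ x {sD sC} → closedWeight sC ≤ closedWeight sD →
    Dominates (push d x false sD) (push d x false sC)
  push-unconnected-monotone x {sD} {sC} C≤D = record
    { closed≤ = subst₂ _≤_ (sym (closedWeight-push-false x sC)) (sym (closedWeight-push-false x sD))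
                  (+-monoˡ-≤ (weight (ph d x)) (+-monoʳ-≤ (weight (pv d x)) C≤D))
    ; flipped≤ = subst₂ _≤_ (sym (flippedWeight-push x false sC)) (sym (flippedWeight-push x false sD))
                  (+-monoʳ-≤ (weight (pv d x)) C≤D) }

  push-monotone : ∀ x c {sD sC} → Dominates sD sC → Dominates (push d x c sD) (push d x c sC)
  push-monotone x true D≥C = push-connected-monotone x D≥C
  push-monotone x false {sD} {sC} D≥C = push-unconnected-monotone x {sD} {sC} (closed≤ D≥C)

  Ahead : Pair → List Pair → Set
  Ahead β B = All (λ x → ONShape d x × β >ᶜ x) B

  cons-dominates : ∀ β b B → ONShape d β → Ahead β (b ∷ B) →
    Dominates (scanChain d (β ∷ b ∷ B)) (scanChain d (b ∷ B))
  cons-dominates β b B onβ β>B =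
    push-dominates β _ (scanChain d (b ∷ B)) onβ (proj₁ ahead) (proj₂ ahead)
    where ahead = last-scanChain d b B β>B

  cons-closed≤ : ∀ β B → ONShape d β → Ahead β B →
    closedWeight (scanChain d B) ≤ closedWeight (scanChain d (β ∷ B))
  cons-closed≤ β [] onβ _ = push-unconnected-closed≤ β (scanChain d []) onβ
  cons-closed≤ β (b ∷ B) onβ β>B = closed≤ (cons-dominates β b B onβ β>B)

  -- a connected to β but not to the head of B: the pending p_h(a) is paid for by p_v(β)
  junction-mixed : ∀ a β B → ONShape d β → T (connected d a β) → Ahead β B →
    Dominates (push d a true (scanChain d (β ∷ B))) (push d a false (scanChain d B))
  junction-mixed a β B onβ a~β β>B = record
    { closed≤ = begin
        closedWeight (push d a false sB)
          ≡⟨ closedWeight-push-false a sB ⟩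
        (weight (pv d a) + closedWeight sB) + weight (ph d a)
          ≤⟨ +-monoʳ-≤ (weight (pv d a) + closedWeight sB) (ph≤pv β a onβ (connected⇒≤star d a β a~β)) ⟩
        (weight (pv d a) + closedWeight sB) + weight (pv d β)
          ≡⟨ reassoc (weight (pv d a)) (closedWeight sB) (weight (pv d β)) ⟩
        weight (pv d a) + (weight (pv d β) + closedWeight sB)
          ≡⟨ cong (λ z → weight (pv d a) + z) (flippedWeight-push β (connectsTo d β B) sB) ⟨
        weight (pv d a) + flippedWeight sβ
          ≡⟨ closedWeight-push-true a sβ ⟨
        closedWeight (push d a true sβ) ∎
    ; flipped≤ = subst₂ _≤_ (sym (flippedWeight-push a false sB)) (sym (flippedWeight-push a true sβ))
                   (+-monoʳ-≤ (weight (pv d a)) (cons-closed≤ β B onβ β>B)) }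
    where
    open ≤-Reasoning
    sB = scanChain d B
    sβ = scanChain d (β ∷ B)
    reassoc : ∀ x y z → (x + y) + z ≡ x + (z + y)
    reassoc = solve-∀

  junction-dominates : ∀ a β B → ONShape d β → a >ᶜ β → Ahead β B → All (a >ᶜ_) B →
    Dominates (scanChain d (a ∷ β ∷ B)) (scanChain d (a ∷ B))
  junction-dominates a β [] onβ a>β β>B a>B with connected d a β in a~β
  ... | true = junction-mixed a β [] onβ (subst T (sym a~β) _) β>B
  ... | false = push-unconnected-monotone a {scanChain d (β ∷ [])} {scanChain d []} (cons-closed≤ β [] onβ β>B)
  junction-dominates a β (b ∷ B) onβ a>β β>B (a>b ∷ _) with connected d a β in a~β | connected d a b in a~b
  ... | true | true = push-connected-monotone a (cons-dominates β b B onβ β>B)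
  ... | true | false = junction-mixed a β (b ∷ B) onβ (subst T (sym a~β) _) β>B
  ... | false | false =
    push-unconnected-monotone a {scanChain d (β ∷ b ∷ B)} {scanChain d (b ∷ B)} (cons-closed≤ β (b ∷ B) onβ β>B)
  ... | false | true = contradiction
    (connected-skip d a β b a>β (proj₂ (All.head β>B)) (subst T (sym a~b) _)) (subst T a~β)

  insertion-dominates : ∀ a A β B → All (ONShape d) (a ∷ A ++ β ∷ B) → AllPairs _>ᶜ_ (a ∷ A ++ β ∷ B) →
    Dominates (scanChain d (a ∷ A ++ β ∷ B)) (scanChain d (a ∷ A ++ B))
  insertion-dominates a [] β B (_ ∷ onβ ∷ onB) ((a>β ∷ a>B) ∷ β>B ∷ _) =
    junction-dominates a β B onβ a>β (All.zip (onB , β>B)) a>B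
  insertion-dominates a (a′ ∷ A) β B (_ ∷ on) (_ ∷ ordered) =
    push-monotone a (connected d a a′) (insertion-dominates a′ A β B on ordered)

  weightSum-S′-insertion : ∀ A β B → All (ONShape d) (A ++ β ∷ B) → AllPairs _>ᶜ_ (A ++ β ∷ B) →
    weightSum (S′ d (A ++ B)) ≤ weightSum (S′ d (A ++ β ∷ B))
  weightSum-S′-insertion A β B on ordered =
    subst₂ _≤_ (sym (weightSum-close (scanChain d (A ++ B)))) (sym (weightSum-close (scanChain d (A ++ β ∷ B))))
      (closed≤-insertion A on ordered)
    where
    closed≤-insertion : ∀ A → All (ONShape d) (A ++ β ∷ B) → AllPairs _>ᶜ_ (A ++ β ∷ B) →
      closedWeight (scanChain d (A ++ B)) ≤ closedWeight (scanChain d (A ++ β ∷ B))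
    closed≤-insertion [] (onβ ∷ onB) (β>B ∷ _) = cons-closed≤ β B onβ (All.zip (onB , β>B))
    closed≤-insertion (a ∷ A) on ordered = closed≤ (insertion-dominates a A β B on ordered)

module Columns (d : ℕ) where

  open import Data.Bool using (true; false; T)
  open import Data.Bool.Properties using (T-∧)
  open import Data.Nat
  open import Data.Nat.Properties
  open import Data.Product using (_×_; _,_; proj₁; proj₂)
  open import Data.Sum using (_⊎_; inj₁; inj₂)
  open import Data.List using ([]; _∷_; map)
  open import Data.List.Relation.Unary.All as All using (All; []; _∷_)
  import Data.List.Relation.Unary.All.Properties as All
  open import Data.List.Relation.Unary.Any as Any using (Any; here; there)
  open import Data.List.Relation.Unary.AllPairs using (AllPairs; []; _∷_)
  open import Data.List.Relation.Unary.Unique.Propositional using (Unique)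
  open import Data.List.Membership.Propositional using (_∈_)
  open import Function.Bundles using (Equivalence)
  open import Relation.Binary.PropositionalEquality
  open import Relation.Nullary using (¬_; yes; no)
  open ScanState

  ON-r≤N : ∀ x → ONShape d x → proj₁ x ≤ suc (2 * d)
  ON-r≤N (r , c) (c<r , r<c*) = <⇒≤ (<-≤-trans r<c* (star≤ d c))

  ON-c≤N : ∀ x → ONShape d x → proj₂ x ≤ suc (2 * d)
  ON-c≤N (r , c) on@(c<r , _) = ≤-trans (<⇒≤ c<r) (ON-r≤N (r , c) on)

  ON-c<r* : ∀ x → ONShape d x → proj₂ x < star d (proj₁ x)
  ON-c<r* (r , c) on@(_ , r<c*) = <-star-swap d (ON-c≤N (r , c) on) r<c*

  ColumnOf : List Pair → ℕ → Set
  ColumnOf L y = Any (λ α → y ≡ proj₂ α ⊎ y ≡ star d (proj₁ α)) L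

  ahead-col< : ∀ x L → ONShape d x → All (x >ᶜ_) L → ∀ {y} → ColumnOf L y → proj₂ x < y
  ahead-col< x L onx x>L = All.lookupWith col< x>L
    where
    col< : ∀ {α y} → x >ᶜ α → y ≡ proj₂ α ⊎ y ≡ star d (proj₁ α) → proj₂ x < y
    col< (rα<rx , cx<cα) (inj₁ refl) = cx<cα
    col< (rα<rx , cx<cα) (inj₂ refl) = <-star-swap d (ON-c≤N x onx) (<-trans rα<rx (proj₂ onx))

  head-extreme : ∀ y ys → AllPairs _>ᶜ_ (y ∷ ys) →
    All (λ α → proj₂ y ≤ proj₂ α × proj₁ α ≤ proj₁ y) (y ∷ ys)
  head-extreme y ys (y>ys ∷ _) =
    (≤-refl , ≤-refl) ∷ All.map (λ (rα<ry , cy<cα) → <⇒≤ cy<cα , <⇒≤ rα<ry) y>ys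

  unconnected-star≢ : ∀ x y ys → ONShape d x → All (ONShape d) (y ∷ ys) → AllPairs _>ᶜ_ (y ∷ ys) →
    All (x >ᶜ_) (y ∷ ys) → ¬ T (connected d x y) → ∀ {z} → ColumnOf (y ∷ ys) z → star d (proj₁ x) ≢ z
  unconnected-star≢ x y ys onx onL ordered x>L x≁y =
    All.lookupWith star≢ (All.zip (x>L , All.zip (onL , head-extreme y ys ordered)))
    where
    star≢ : ∀ {α z} → x >ᶜ α × ONShape d α × proj₂ y ≤ proj₂ α × proj₁ α ≤ proj₁ y →
      z ≡ proj₂ α ⊎ z ≡ star d (proj₁ α) → star d (proj₁ x) ≢ z
    star≢ ((rα<rx , _) , _) (inj₂ refl) = <⇒≢ (star-antitone-< d rα<rx (ON-r≤N x onx))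
    star≢ {α} (_ , onα , cy≤cα , rα≤ry) (inj₁ refl) with proj₁ x ≤? star d (proj₂ y)
    ... | no rx≰cy* =
      <⇒≢ (<-≤-trans (star-<-swap d (ON-c≤N y (All.head onL)) (ON-r≤N x onx) (≰⇒> rx≰cy*)) cy≤cα)
    ... | yes rx≤cy* = λ eq → <⇒≢ (<-≤-trans (proj₁ onα) (≤-trans rα≤ry ry≤rx*)) (sym eq)
      where ry≤rx* = ≮⇒≥ (λ rx*<ry → x≁y (Equivalence.from T-∧ (≤⇒≤ᵇ rx≤cy* , <⇒<ᵇ rx*<ry)))

  record ColumnInvariant (L : List Pair) (s : ScanState) : Set where
    field
      unique       : Unique (map proj₂ (pairs s))
      pendingFresh : All (λ p → star d (proj₁ (last s)) ≢ proj₂ p) (pairs s)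
      columnsOf    : All (λ p → ColumnOf L (proj₂ p)) (pairs s)
      last∈        : last s ∈ L
  open ColumnInvariant

  fresh : ∀ {c : ℕ} (P : List Pair) → All (λ p → c ≢ proj₂ p) P → All (c ≢_) (map proj₂ P)
  fresh P = All.map⁺ {f = proj₂}

  ahead-fresh : ∀ x L (P : List Pair) → ONShape d x → All (x >ᶜ_) L → All (λ p → ColumnOf L (proj₂ p)) P →
    All (λ p → proj₂ x ≢ proj₂ p) P
  ahead-fresh x L P onx x>L = All.map (λ p∈L → <⇒≢ (ahead-col< x L onx x>L p∈L))

  last-column : ∀ {L ℓ} → ℓ ∈ L → ColumnOf L (star d (proj₁ ℓ))
  last-column = Any.map (λ { refl → inj₂ refl })

  push-connected-invariant : ∀ x L s → ONShape d x → All (x >ᶜ_) L →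
    ColumnInvariant L s → ColumnInvariant (x ∷ L) (push d x true s)
  push-connected-invariant x L (scan P o ℓ) onx x>L inv = record
    { unique = fresh P (ahead-fresh x L P onx x>L (columnsOf inv)) ∷ unique inv
    ; pendingFresh = (λ eq → <⇒≢ (ahead-col< x L onx x>L (last-column (last∈ inv))) (sym eq)) ∷ pendingFresh inv
    ; columnsOf = here (inj₁ refl) ∷ All.map there (columnsOf inv)
    ; last∈ = there (last∈ inv) }

  push-unconnected-invariant : ∀ x L s → ONShape d x → All (x >ᶜ_) L →
    (∀ {z} → ColumnOf L z → star d (proj₁ x) ≢ z) →
    ColumnInvariant L s → ColumnInvariant (x ∷ L) (push d x false s)
  push-unconnected-invariant x L (scan P true ℓ) onx x>L x*≢L inv = record
    { unique = fresh (ph d ℓ ∷ P) ((λ eq → <⇒≢ cx<rℓ* eq) ∷ ahead-fresh x L P onx x>L (columnsOf inv))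
               ∷ fresh P (pendingFresh inv) ∷ unique inv
    ; pendingFresh = (λ eq → <⇒≢ (ON-c<r* x onx) (sym eq))
                     ∷ (λ eq → <⇒≢ (star-antitone-< d (proj₁ (All.lookup x>L (last∈ inv))) (ON-r≤N x onx)) eq)
                     ∷ All.map x*≢L (columnsOf inv)
    ; columnsOf = here (inj₁ refl) ∷ there (last-column (last∈ inv)) ∷ All.map there (columnsOf inv)
    ; last∈ = here refl }
    where cx<rℓ* = ahead-col< x L onx x>L (last-column (last∈ inv))
  push-unconnected-invariant x L (scan P false ℓ) onx x>L x*≢L inv = record
    { unique = fresh P (ahead-fresh x L P onx x>L (columnsOf inv)) ∷ unique inv
    ; pendingFresh = (λ eq → <⇒≢ (ON-c<r* x onx) (sym eq)) ∷ All.map x*≢L (columnsOf inv)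
    ; columnsOf = here (inj₁ refl) ∷ All.map there (columnsOf inv)
    ; last∈ = here refl }

  scan-invariant : ∀ y ys → All (ONShape d) (y ∷ ys) → AllPairs _>ᶜ_ (y ∷ ys) →
    ColumnInvariant (y ∷ ys) (scanChain d (y ∷ ys))
  scan-invariant y [] (ony ∷ []) _ = record
    { unique = [] ∷ []
    ; pendingFresh = (λ eq → <⇒≢ (ON-c<r* y ony) (sym eq)) ∷ []
    ; columnsOf = here (inj₁ refl) ∷ []
    ; last∈ = here refl }
  scan-invariant x (y ∷ ys) (onx ∷ onL) (x>L ∷ ordered) with connected d x y in x~y
  ... | true = push-connected-invariant x (y ∷ ys) _ onx x>L (scan-invariant y ys onL ordered)
  ... | false = push-unconnected-invariant x (y ∷ ys) _ onx x>L
                  (unconnected-star≢ x y ys onx onL ordered x>L (subst T x~y))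
                  (scan-invariant y ys onL ordered)

  S′-columns-unique : ∀ L → All (ONShape d) L → AllPairs _>ᶜ_ L → Unique (map proj₂ (S′ d L))
  S′-columns-unique [] _ _ = []
  S′-columns-unique (y ∷ ys) on ordered with scanChain d (y ∷ ys) | scan-invariant y ys on ordered
  ... | scan P true ℓ | inv = fresh P (pendingFresh inv) ∷ unique inv
  ... | scan P false ℓ | inv = unique inv

module Comparison (d : ℕ) (v : List ℕ) (v∈I : InId d v) where

  open import Data.Bool using (Bool; true; false; T; not; _∧_; _∨_)
  open import Data.Nat
  open import Data.Nat.Properties
  open import Data.Integer as ℤ using (ℤ; +_)
  import Data.Integer.Properties as ℤ
  open import Data.Integer.Tactic.RingSolver using (solve-∀)
  open import Data.Product using (_×_; _,_; proj₁; proj₂)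
  open import Data.Sum using (inj₁; inj₂)
  open import Data.List using ([]; _∷_; _++_; map; length; upTo; filterᵇ)
  open import Data.List.Properties using (length-map)
  open import Data.List.Relation.Unary.All as All using (All; []; _∷_)
  import Data.List.Relation.Unary.All.Properties as All
  open import Data.List.Relation.Unary.AllPairs as AllPairs using (AllPairs; []; _∷_)
  import Data.List.Relation.Unary.AllPairs.Properties as AllPairs
  open import Data.List.Relation.Unary.Linked.Properties using (Linked⇒AllPairs)
  open import Data.List.Relation.Unary.Unique.Propositional using (Unique)
  open import Data.List.Relation.Binary.Sublist.Propositional using (_∷ʳ_; ⊆-refl)
  open import Data.List.Relation.Binary.Sublist.Propositional.Properties using (++⁺)
  open import Data.List.Membership.Propositional using (_∈_; _∉_)
  open import Data.List.Membership.Propositional.Properties using (∈-map⁺; ∈-map⁻; ∈-upTo⁺; ∈-upTo⁻)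
  open import Function using (_∘_)
  open import Relation.Binary.PropositionalEquality
  open import Relation.Nullary using (¬_; contradiction)
  import Data.List.Relation.Binary.Pointwise as Pointwise

  +-as-difference : ∀ {k c n r} → k + c ≡ n + r → + k ≡ + n ℤ.- (+ c ℤ.- + r)
  +-as-difference {k} {c} {n} {r} eq = begin
    + k                            ≡⟨ cancel (+ k) (+ c) ⟩
    (+ k ℤ.+ + c) ℤ.- + c
      ≡⟨ cong (ℤ._- + c) (trans (sym (ℤ.pos-+ k c)) (trans (cong +_ eq) (ℤ.pos-+ n r))) ⟩
    (+ n ℤ.+ + r) ℤ.- + c          ≡⟨ regroup (+ n) (+ c) (+ r) ⟩
    + n ℤ.- (+ c ℤ.- + r)          ∎
    where
    open ≡-Reasoning
    cancel : ∀ (x y : ℤ) → x ≡ (x ℤ.+ y) ℤ.- y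
    cancel = solve-∀
    regroup : ∀ (x y z : ℤ) → (x ℤ.+ z) ℤ.- y ≡ x ℤ.- (y ℤ.- z)
    regroup = solve-∀

  InRange : ℕ → Set
  InRange y = 1 ≤ y × y ≤ 2 * d

  X : List ℕ
  X = map suc (upTo (2 * d))

  X-increasing : AllPairs _<_ X
  X-increasing = AllPairs.map⁺ (AllPairs.applyUpTo⁺₁ (λ i → i) (2 * d) (λ i<j _ → s<s i<j))

  X-unique : Unique X
  X-unique = AllPairs.map <⇒≢ X-increasing

  range⇒∈X : ∀ {y} → InRange y → y ∈ X
  range⇒∈X {suc y} (_ , y<2d) = ∈-map⁺ suc (∈-upTo⁺ y<2d)

  X-range : All InRange X
  X-range = All.tabulate range
    where
    range : ∀ {y} → y ∈ X → InRange y
    range y∈X with ∈-map⁻ suc y∈X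
    ... | i , i∈ , refl = s≤s z≤n , ∈-upTo⁻ i∈

  star-range : ∀ {y} → InRange y → InRange (star d y)
  star-range {y} (1≤y , y≤2d) =
    subst (_≤ star d y) (m+n∸n≡m 1 (2 * d)) (∸-monoʳ-≤ (suc (2 * d)) y≤2d) , ∸-monoʳ-≤ (suc (2 * d)) 1≤y

  v-range : ∀ {y} → y ∈ v → InRange y
  v-range = All.lookup (InId2d.bounds (InId.inId2d v∈I))

  star∉v : ∀ {c} → c ∈ v → star d c ∉ v
  star∉v {c} c∈v c*∈v = InId.notBoth v∈I c (proj₁ (v-range c∈v)) (proj₂ (v-range c∈v)) (c∈v , c*∈v)

  Exchange : Pair → Set
  Exchange (r , c) = r ≡ star d c × c ∈ v

  pv-exchange : ∀ {α} → InON d v α → Exchange (pv d α)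
  pv-exchange (_ , c∈v , _) = refl , c∈v

  ph-exchange : ∀ {α} → InON d v α → Exchange (ph d α)
  ph-exchange {r , c} (r∉v , c∈v , c<r , r<c*) =
    sym (star-involutive d (≤-trans r≤2d (n≤1+n _))) , r*∈v
    where
    1≤r = ≤-trans (proj₁ (v-range c∈v)) (<⇒≤ c<r)
    r≤2d = s≤s⁻¹ (<-≤-trans r<c* (star≤ d c))
    r*∈v : star d r ∈ v
    r*∈v with InId.oneOf v∈I r 1≤r r≤2d
    ... | inj₁ r∈v = contradiction r∈v r∉v
    ... | inj₂ r*∈v = r*∈v

  S′-exchanges : ∀ {C} → All (InON d v) C → All Exchange (S′ d C)
  S′-exchanges {C} on = All-S′ d C (All.map (λ onα → pv-exchange onα , ph-exchange onα) on)

  exchange-col-range : ∀ {p} → Exchange p → InRange (proj₂ p)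
  exchange-col-range (_ , c∈v) = v-range c∈v

  exchange-row-range : ∀ {p} → Exchange p → InRange (proj₁ p)
  exchange-row-range (refl , c∈v) = star-range (v-range c∈v)

  cols rows : List Pair → List ℕ
  cols C = map proj₂ (S′ d C)
  rows C = map proj₁ (S′ d C)

  rows-unique : ∀ P → All Exchange P → Unique (map proj₂ P) → Unique (map proj₁ P)
  rows-unique [] [] [] = []
  rows-unique (p ∷ P) (ep ∷ eP) (p∉P ∷ P!) =
    All.map⁺ (All.zipWith distinct (All.map⁻ p∉P , eP)) ∷ rows-unique P eP P!
    where
    distinct : ∀ {q} → proj₂ p ≢ proj₂ q × Exchange q → proj₁ p ≢ proj₁ q
    distinct {q} (cp≢cq , eq) rp≡rq =
      cp≢cq (star-injective d (c≤N ep) (c≤N eq) (trans (sym (proj₁ ep)) (trans rp≡rq (proj₁ eq))))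
      where
      c≤N : ∀ {q} → Exchange q → proj₂ q ≤ suc (2 * d)
      c≤N e = ≤-trans (proj₂ (exchange-col-range e)) (n≤1+n _)

  keep : List Pair → ℕ → Bool
  keep P x = (elemᵇ x v ∧ not (elemᵇ x (map proj₂ P))) ∨ elemᵇ x (map proj₁ P)

  exchange-pointwise : ∀ bv bc br → (T bc → T bv) → (T br → ¬ T bv) →
    toℕ ((bv ∧ not bc) ∨ br) + toℕ bc ≡ toℕ bv + toℕ br
  exchange-pointwise true true true _ r∉v = contradiction _ (r∉v _)
  exchange-pointwise true true false _ _ = refl
  exchange-pointwise true false true _ r∉v = contradiction _ (r∉v _)
  exchange-pointwise true false false _ _ = refl
  exchange-pointwise false true br c∈v _ = contradiction (c∈v _) λ ()
  exchange-pointwise false false br _ _ = +-identityʳ (toℕ br)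

  exchange-count : ∀ P → All Exchange P → ∀ ys →
    count (keep P) ys + count (λ x → elemᵇ x (map proj₂ P)) ys
      ≡ count (λ x → elemᵇ x v) ys + count (λ x → elemᵇ x (map proj₁ P)) ys
  exchange-count P eP = count-linear _ _ _ _ λ x →
    exchange-pointwise (elemᵇ x v) (elemᵇ x (map proj₂ P)) (elemᵇ x (map proj₁ P)) (col∈v x) (row∉v x)
    where
    col∈v : ∀ x → T (elemᵇ x (map proj₂ P)) → T (elemᵇ x v)
    col∈v x x∈cols with ∈-map⁻ proj₂ (elemᵇ⇒∈ x (map proj₂ P) x∈cols)
    ... | p , p∈P , refl = ∈⇒elemᵇ (proj₂ (All.lookup eP p∈P))
    row∉v : ∀ x → T (elemᵇ x (map proj₁ P)) → ¬ T (elemᵇ x v)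
    row∉v x x∈rows x∈v with ∈-map⁻ proj₁ (elemᵇ⇒∈ x (map proj₁ P) x∈rows)
    ... | p , p∈P , refl with All.lookup eP p∈P
    ...   | r≡c* , c∈v = star∉v c∈v (subst (_∈ v) r≡c* (elemᵇ⇒∈ x v x∈v))

  v-unique : Unique v
  v-unique = AllPairs.map <⇒≢ (Linked⇒AllPairs <-trans (InId2d.increasing (InId.inId2d v∈I)))

  cols-unique : ∀ {C} → Chain d v C → Unique (cols C)
  cols-unique {C} (on , ordered) = Columns.S′-columns-unique d C (All.map (InON⇒ONShape {d} {v}) on) ordered

  countUpTo-w : ∀ C t → Chain d v C →
    countUpTo t (w d v C) + countUpTo t (cols C) ≡ countUpTo t v + countUpTo t (rows C)
  countUpTo-w C t chain@(on , _) = begin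
    countUpTo t (w d v C) + countUpTo t (cols C)
      ≡⟨ cong₂ _+_ (count-filterᵇ (keep (S d C)) (_≤ᵇ t) X)
                   (sym (countIn (cols C) (cols-unique chain) (range-⊆ cols-range))) ⟩
    count (keep (S d C)) Y + count (_∈ᵇ cols C) Y
      ≡⟨ cong (_+ count (_∈ᵇ cols C) Y) (count-cong keep-S≗keep-S′ Y) ⟩
    count (keep (S′ d C)) Y + count (_∈ᵇ cols C) Y
      ≡⟨ exchange-count (S′ d C) exchanges Y ⟩
    count (_∈ᵇ v) Y + count (_∈ᵇ rows C) Y
      ≡⟨ cong₂ _+_ (countIn v v-unique (All.tabulate (range⇒∈X ∘ v-range)))
                   (countIn (rows C) (rows-unique (S′ d C) exchanges (cols-unique chain)) (range-⊆ rows-range)) ⟩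
    countUpTo t v + countUpTo t (rows C) ∎
    where
    open ≡-Reasoning
    _∈ᵇ_ : ℕ → List ℕ → Bool
    x ∈ᵇ M = elemᵇ x M
    Y = filterᵇ (_≤ᵇ t) X
    exchanges = S′-exchanges on
    countIn : ∀ M → Unique M → All (_∈ X) M → count (_∈ᵇ M) Y ≡ countUpTo t M
    countIn M M! M⊆X = count-elemᵇ-filterᵇ (_≤ᵇ t) X-unique M! M⊆X
    range-⊆ : ∀ {M} → All InRange M → All (_∈ X) M
    range-⊆ = All.map range⇒∈X
    cols-range = All.map⁺ (All.map exchange-col-range exchanges)
    rows-range = All.map⁺ (All.map exchange-row-range exchanges)
    keep-S≗keep-S′ : ∀ x → keep (S d C) x ≡ keep (S′ d C) x
    keep-S≗keep-S′ x = cong₂ (λ a b → (elemᵇ x v ∧ not a) ∨ b)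
      (SameRowsCols.sameCols (S≈S′ d C) x) (SameRowsCols.sameRows (S≈S′ d C) x)

  w-increasing : ∀ C → AllPairs _<_ (w d v C)
  w-increasing C = AllPairs.filter⁺ _ X-increasing

  length-w : ∀ C → Chain d v C → length (w d v C) ≡ countUpTo (2 * d) v
  length-w C chain@(on , _) = +-cancelʳ-≡ (length (cols C)) _ _ (begin
    length (w d v C) + length (cols C)
      ≡⟨ cong₂ _+_ (countUpTo-all w≤2d) (countUpTo-all cols≤2d) ⟨
    countUpTo (2 * d) (w d v C) + countUpTo (2 * d) (cols C)
      ≡⟨ countUpTo-w C (2 * d) chain ⟩
    countUpTo (2 * d) v + countUpTo (2 * d) (rows C)
      ≡⟨ cong (λ n → countUpTo (2 * d) v + n) (trans (countUpTo-all rows≤2d) same-length) ⟩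
    countUpTo (2 * d) v + length (cols C) ∎)
    where
    open ≡-Reasoning
    exchanges = S′-exchanges on
    w≤2d = All.filter⁺ _ (All.map proj₂ X-range)
    cols≤2d = All.map⁺ (All.map (proj₂ ∘ exchange-col-range) exchanges)
    rows≤2d = All.map⁺ (All.map (proj₂ ∘ exchange-row-range) exchanges)
    same-length : length (rows C) ≡ length (cols C)
    same-length = trans (length-map proj₁ (S′ d C)) (sym (length-map proj₂ (S′ d C)))

  countUpTo-w-weightSum : ∀ C t → Chain d v C →
    + countUpTo t (w d v C) ≡ + countUpTo t v ℤ.- Weights.weightSum d t (S′ d C)
  countUpTo-w-weightSum C t chain = begin
    + countUpTo t (w d v C)
      ≡⟨ +-as-difference {countUpTo t (w d v C)} {countUpTo t (cols C)} {countUpTo t v} {countUpTo t (rows C)}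
           (countUpTo-w C t chain) ⟩
    + countUpTo t v ℤ.- (+ countUpTo t (cols C) ℤ.- + countUpTo t (rows C))
      ≡⟨ cong (λ z → + countUpTo t v ℤ.- z) (Weights.weightSum-countUpTo d t (S′ d C)) ⟨
    + countUpTo t v ℤ.- Weights.weightSum d t (S′ d C) ∎
    where open ≡-Reasoning

  w-insertion : ∀ A β B → Chain d v (A ++ β ∷ B) → w d v (A ++ B) ≤I w d v (A ++ β ∷ B)
  w-insertion A β B chainD@(onD , orderedD) =
    pointwise-≤-fromCountUpTo (w-increasing C) (w-increasing D) (trans (length-w C chainC) (sym (length-w D chainD)))
      λ t → ℤ.drop‿+≤+ (begin
        + countUpTo t (w d v D)
          ≡⟨ countUpTo-w-weightSum D t chainD ⟩
        + countUpTo t v ℤ.- Weights.weightSum d t (S′ d D)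
          ≤⟨ ℤ.+-monoʳ-≤ (+ countUpTo t v) (ℤ.neg-mono-≤ (weights≤ t)) ⟩
        + countUpTo t v ℤ.- Weights.weightSum d t (S′ d C)
          ≡⟨ countUpTo-w-weightSum C t chainC ⟨
        + countUpTo t (w d v C) ∎)
    where
    open ℤ.≤-Reasoning
    C = A ++ B
    D = A ++ β ∷ B
    chainC : Chain d v C
    chainC = Chain-resp-⊆ {d} {v} (++⁺ ⊆-refl (β ∷ʳ ⊆-refl)) chainD
    weights≤ : ∀ t → Weights.weightSum d t (S′ d C) ℤ.≤ Weights.weightSum d t (S′ d D)
    weights≤ t = Weights.weightSum-S′-insertion d t A β B (All.map (InON⇒ONShape {d} {v}) onD) orderedD

  w-monotone : ∀ {C D} → C ⊆ D → Chain d v D → w d v C ≤I w d v D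
  w-monotone = ⊆-monotone-from-insertions (Chain d v) (λ C D → w d v C ≤I w d v D) (Chain-resp-⊆ {d} {v})
    (Pointwise.refl ≤-refl) (Pointwise.transitive ≤-trans) w-insertion

corollary6p2 : (d : ℕ) (v : List ℕ) (C D : List Pair) →
    InId d v → IsChain d v C → IsChain d v D → C ⊆ D →
    w d v C ≤I w d v D
corollary6p2 d v C D v∈I _ D-chain C⊆D = Comparison.w-monotone d v v∈I C⊆D (IsChain⇒Chain {d} {v} D-chain)
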